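{- Let $q=2mn+1$ be a prime power. There exists a rank-one Heffter array H$(m,n)$ over $\mathbb{F}_q$ if and only if there is a half-set $V$ of $\mathbb{F}_q$ and zero-sum subsets $X,Y\subseteq\mathbb{F}_q^*$ with $|X|=m$, $|Y|=n$, such that $V$ factorizes as $X\cdot Y$, i.e. every element of $V$ can be written in exactly one way as $xy$ with $x\in X$, $y\in Y$, and $V=\{xy: x\in X, y\in Y\}$.
   Context: A half-set of an additive group $G$ of odd order $2\ell+1$ is an $\ell$-subset $L$ of $G$ with $L\cup -L=G\setminus\{0\}$. A (multi)subset of an additive abelian group is zero-sum if the sum of all its elements is $0$. A Heffter array H$(m,n)$ over an additive group $G$ of order $2mn+1$ is an $m\times n$ matrix whose entries form a half-set of $G$ and whose rows and columns all sum to zero. A Heffter array over $\mathbb{F}_q$ means over the additive group of $\mathbb{F}_q$; it is rank-one if, as a matrix over the field $\mathbb{F}_q$, it has rank $1$. -}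

module Defs where

open import Level using (0ℓ)
open import Data.Nat as ℕ using (ℕ; zero; suc; _^_; _≥_)
open import Data.Nat.Primality using (Prime)
open import Data.Fin using (Fin; zero; suc)
open import Data.Product using (Σ; _×_; _,_; proj₁; proj₂; ∃)
open import Data.Sum using (_⊎_)
open import Relation.Binary.PropositionalEquality using (_≡_; _≢_)
open import Algebra.Structures using (IsCommutativeRing)
open import Function.Bundles using (_↔_)

IsPrimePower : ℕ → Set
IsPrimePower q = Σ ℕ λ p → Σ ℕ λ k → Prime p × k ≥ 1 × q ≡ p ^ k

-- A finite field with exactly q elements (equality is propositional equality;
-- any finite field can be presented this way).
record FiniteField (q : ℕ) : Set₁ where
  infixl 7 _*_
  infixl 6 _+_
  infix  8 -_
  field
    Carrier  : Set
    _+_ _*_  : Carrier → Carrier → Carrier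
    -_       : Carrier → Carrier
    0# 1#    : Carrier
    isCommutativeRing : IsCommutativeRing _≡_ _+_ _*_ -_ 0# 1#
    0≢1      : 0# ≢ 1#
    inverse  : (x : Carrier) → x ≢ 0# → Σ Carrier λ y → x * y ≡ 1#
    enumeration : Fin q ↔ Carrier

module _ {q : ℕ} (𝔽 : FiniteField q) where
  open FiniteField 𝔽

  ∑ : {k : ℕ} → (Fin k → Carrier) → Carrier
  ∑ {zero}  f = 0#
  ∑ {suc k} f = f zero + ∑ (λ i → f (suc i))

  -- The family L (indexed by I) enumerates, without repetition, a half-set of
  -- the additive group: L ∪ -L = G ∖ {0}  (0 ∉ L, and every nonzero g lies in L or -L).
  IsHalfSet : {I : Set} → (I → Carrier) → Set
  IsHalfSet {I} L =
      (∀ a b → L a ≡ L b → a ≡ b)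
    × (∀ a → L a ≢ 0#)
    × (∀ g → g ≢ 0# → (∃ λ a → L a ≡ g) ⊎ (∃ λ a → L a ≡ - g))

  Matrix : ℕ → ℕ → Set
  Matrix m n = Fin m → Fin n → Carrier

  IsHeffter : {m n : ℕ} → Matrix m n → Set
  IsHeffter {m} {n} A =
      IsHalfSet {Fin m × Fin n} (λ p → A (proj₁ p) (proj₂ p))
    × (∀ i → ∑ (λ j → A i j) ≡ 0#)
    × (∀ j → ∑ (λ i → A i j) ≡ 0#)

  IsRankOne : {m n : ℕ} → Matrix m n → Set
  IsRankOne {m} {n} A =
      (Σ (Fin m × Fin n) λ p → A (proj₁ p) (proj₂ p) ≢ 0#)
    × (Σ (Fin m → Carrier) λ u → Σ (Fin n → Carrier) λ v →
         ∀ i j → A i j ≡ u i * v j)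

  IsZeroSumSubsetOfUnits : {k : ℕ} → (Fin k → Carrier) → Set
  IsZeroSumSubsetOfUnits X =
      (∀ a b → X a ≡ X b → a ≡ b)
    × (∀ a → X a ≢ 0#)
    × ∑ X ≡ 0#

  Factorizes : {ℓ m n : ℕ} → (Fin ℓ → Carrier) → (Fin m → Carrier) → (Fin n → Carrier) → Set
  Factorizes {ℓ} {m} {n} V X Y =
      (∀ k → Σ (Fin m × Fin n) λ p →
               X (proj₁ p) * Y (proj₂ p) ≡ V k
             × (∀ p′ → X (proj₁ p′) * Y (proj₂ p′) ≡ V k → p′ ≡ p))
    × (∀ i j → ∃ λ k → V k ≡ X i * Y j)

{-# OPTIONS --safe #-}
module Submission where

-- If A = u vᵀ is a rank-one Heffter array, its entries are nonzero and distinct, so u and v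
-- are injective and zero-free, and a zero column sum (Σ u)·v_j = 0 with v_j ≠ 0 gives
-- Σ u = 0 (likewise Σ v = 0); reading off the entries of A gives the half-set V = u·v.
-- Conversely, for zero-sum sets of units X and Y the outer product X Yᵀ has zero row and
-- column sums, and uniqueness of factorizations makes its entries distinct, so they
-- enumerate the half-set V.

open import Level using (0ℓ)
open import Data.Nat using (ℕ)
open import Data.Fin using (Fin; zero; suc)
open import Data.Fin.Properties using (*↔×)
open import Data.Product using (Σ; ∃; _×_; _,_; proj₁; proj₂; uncurry)
open import Data.Sum using ([_,_]′) renaming (map to ⊎-map)
open import Function using (_∘_)
open import Function.Bundles using (_⇔_; _↔_; mk⇔; Inverse; Injection)
open import Function.Properties.Inverse using (↔⇒↣)
open import Relation.Binary.PropositionalEquality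
open import Algebra.Bundles using (Semiring)
open import Algebra.Structures using (IsCommutativeRing)

open import Defs

module _ {q : ℕ} (𝔽 : FiniteField q) where
  open FiniteField 𝔽
  open IsCommutativeRing isCommutativeRing
    using (isSemiring; *-comm; *-assoc; *-identityʳ; zeroˡ; zeroʳ)

  semiring : Semiring 0ℓ 0ℓ
  semiring = record
    { Carrier = Carrier ; _≈_ = _≡_ ; _+_ = _+_ ; _*_ = _*_ ; 0# = 0# ; 1# = 1#
    ; isSemiring = isSemiring }

  open import Algebra.Properties.Semiring.Sum semiring
    using (sum; sum-cong-≗; *-distribˡ-sum; *-distribʳ-sum)

  ∑≡sum : ∀ {k} (f : Fin k → Carrier) → ∑ 𝔽 f ≡ sum f
  ∑≡sum {ℕ.zero}  f = refl
  ∑≡sum {ℕ.suc k} f = cong (f zero +_) (∑≡sum (f ∘ suc))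

  ∑-cong : ∀ {k} {f g : Fin k → Carrier} → (∀ i → f i ≡ g i) → ∑ 𝔽 f ≡ ∑ 𝔽 g
  ∑-cong {f = f} {g} f≗g = begin
    ∑ 𝔽 f  ≡⟨ ∑≡sum f ⟩
    sum f  ≡⟨ sum-cong-≗ f≗g ⟩
    sum g  ≡⟨ ∑≡sum g ⟨
    ∑ 𝔽 g  ∎
    where open ≡-Reasoning

  ∑-*ˡ : ∀ {k} c (f : Fin k → Carrier) → ∑ 𝔽 (λ i → c * f i) ≡ c * ∑ 𝔽 f
  ∑-*ˡ c f = begin
    ∑ 𝔽 (λ i → c * f i)  ≡⟨ ∑≡sum (λ i → c * f i) ⟩
    sum (λ i → c * f i)  ≡⟨ *-distribˡ-sum c f ⟨
    c * sum f            ≡⟨ cong (c *_) (∑≡sum f) ⟨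
    c * ∑ 𝔽 f            ∎
    where open ≡-Reasoning

  ∑-*ʳ : ∀ {k} c (f : Fin k → Carrier) → ∑ 𝔽 (λ i → f i * c) ≡ ∑ 𝔽 f * c
  ∑-*ʳ c f = begin
    ∑ 𝔽 (λ i → f i * c)  ≡⟨ ∑≡sum (λ i → f i * c) ⟩
    sum (λ i → f i * c)  ≡⟨ *-distribʳ-sum c f ⟨
    sum f * c            ≡⟨ cong (_* c) (∑≡sum f) ⟨
    ∑ 𝔽 f * c            ∎
    where open ≡-Reasoning

  x*y≡0⇒x≡0 : ∀ {x y} → y ≢ 0# → x * y ≡ 0# → x ≡ 0#
  x*y≡0⇒x≡0 {x} {y} y≢0 xy≡0 with inverse y y≢0
  ... | y⁻¹ , yy⁻¹≡1 = begin
    x               ≡⟨ *-identityʳ x ⟨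
    x * 1#          ≡⟨ cong (x *_) yy⁻¹≡1 ⟨
    x * (y * y⁻¹)   ≡⟨ *-assoc x y y⁻¹ ⟨
    (x * y) * y⁻¹   ≡⟨ cong (_* y⁻¹) xy≡0 ⟩
    0# * y⁻¹        ≡⟨ zeroˡ y⁻¹ ⟩
    0#              ∎
    where open ≡-Reasoning

  x≢0∧y≢0⇒x*y≢0 : ∀ {x y} → x ≢ 0# → y ≢ 0# → x * y ≢ 0#
  x≢0∧y≢0⇒x*y≢0 x≢0 y≢0 = x≢0 ∘ x*y≡0⇒x≡0 y≢0

  x*y≢0⇒x≢0 : ∀ {x y} → x * y ≢ 0# → x ≢ 0#
  x*y≢0⇒x≢0 {x} {y} xy≢0 x≡0 = xy≢0 (trans (cong (_* y) x≡0) (zeroˡ y))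

  x*y≢0⇒y≢0 : ∀ {x y} → x * y ≢ 0# → y ≢ 0#
  x*y≢0⇒y≢0 {x} {y} xy≢0 y≡0 = xy≢0 (trans (cong (x *_) y≡0) (zeroʳ x))

  -- IsHalfSet imposes no bound on the size of the family, so enlarging a half-set by
  -- further distinct nonzero elements keeps it one.
  IsHalfSet-⊇ : {I J : Set} {L : I → Carrier} {M : J → Carrier} → IsHalfSet 𝔽 L →
    (∀ b b′ → M b ≡ M b′ → b ≡ b′) → (∀ b → M b ≢ 0#) → (∀ a → ∃ λ b → M b ≡ L a) →
    IsHalfSet 𝔽 M
  IsHalfSet-⊇ {L = L} {M} (_ , _ , L-covers) M-injective M≢0 L⊆M =
    M-injective , M≢0 , λ g g≢0 → ⊎-map enlarge enlarge (L-covers g g≢0)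
    where
    enlarge : ∀ {g} → ∃ (λ a → L a ≡ g) → ∃ λ b → M b ≡ g
    enlarge (a , La≡g) = let (b , Mb≡La) = L⊆M a in b , trans Mb≡La La≡g

  IsHalfSet-∘↔ : {I J : Set} {L : I → Carrier} (e : J ↔ I) → IsHalfSet 𝔽 L →
    IsHalfSet 𝔽 (L ∘ Inverse.to e)
  IsHalfSet-∘↔ {L = L} e L-half@(L-injective , L≢0 , _) =
    IsHalfSet-⊇ L-half
      (λ b b′ → Injection.injective (↔⇒↣ e) ∘ L-injective _ _)
      (L≢0 ∘ Inverse.to e)
      (λ a → Inverse.from e a , cong L (Inverse.strictlyInverseˡ e a))

  IsHalfSet⇒inhabited : {I : Set} {L : I → Carrier} → IsHalfSet 𝔽 L → I
  IsHalfSet⇒inhabited (_ , _ , covers) = [ proj₁ , proj₁ ]′ (covers 1# (0≢1 ∘ sym))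

  IsZeroSumSubsetOfUnits-*ʳ⁻¹ : ∀ {k c} {f w : Fin k → Carrier} → c ≢ 0# →
    (∀ a → f a ≡ w a * c) → IsZeroSumSubsetOfUnits 𝔽 f → IsZeroSumSubsetOfUnits 𝔽 w
  IsZeroSumSubsetOfUnits-*ʳ⁻¹ {c = c} {f} {w} c≢0 f≡wc (f-injective , f≢0 , ∑f≡0) =
    w-injective , (λ a → x*y≢0⇒x≢0 (f≢0 a ∘ trans (f≡wc a))) , x*y≡0⇒x≡0 c≢0 ∑w*c≡0
    where
    w-injective : ∀ a b → w a ≡ w b → a ≡ b
    w-injective a b wa≡wb =
      f-injective a b (trans (f≡wc a) (trans (cong (_* c) wa≡wb) (sym (f≡wc b))))

    ∑w*c≡0 : ∑ 𝔽 w * c ≡ 0#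
    ∑w*c≡0 = begin
      ∑ 𝔽 w * c            ≡⟨ ∑-*ʳ c w ⟨
      ∑ 𝔽 (λ a → w a * c)  ≡⟨ ∑-cong f≡wc ⟨
      ∑ 𝔽 f                ≡⟨ ∑f≡0 ⟩
      0#                   ∎
      where open ≡-Reasoning

  module _ {m n : ℕ} {A : Matrix 𝔽 m n} where
    IsHeffter⇒row-IsZeroSumSubsetOfUnits : IsHeffter 𝔽 A →
      ∀ i → IsZeroSumSubsetOfUnits 𝔽 (λ j → A i j)
    IsHeffter⇒row-IsZeroSumSubsetOfUnits ((A-injective , A≢0 , _) , rows , _) i =
        (λ j j′ e → cong proj₂ (A-injective (i , j) (i , j′) e))
      , (λ j → A≢0 (i , j))
      , rows i

    IsHeffter⇒column-IsZeroSumSubsetOfUnits : IsHeffter 𝔽 A →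
      ∀ j → IsZeroSumSubsetOfUnits 𝔽 (λ i → A i j)
    IsHeffter⇒column-IsZeroSumSubsetOfUnits ((A-injective , A≢0 , _) , _ , columns) j =
        (λ i i′ e → cong proj₁ (A-injective (i , j) (i′ , j) e))
      , (λ i → A≢0 (i , j))
      , columns j

  infix 7 _⊗_
  _⊗_ : ∀ {m n} → (Fin m → Carrier) → (Fin n → Carrier) → Matrix 𝔽 m n
  (u ⊗ v) i j = u i * v j

  ⊗-row-sum : ∀ {m n} (X : Fin m → Carrier) (Y : Fin n → Carrier) → ∑ 𝔽 Y ≡ 0# →
    ∀ i → ∑ 𝔽 (λ j → (X ⊗ Y) i j) ≡ 0#
  ⊗-row-sum X Y ∑Y≡0 i = trans (∑-*ˡ (X i) Y) (trans (cong (X i *_) ∑Y≡0) (zeroʳ (X i)))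

  ⊗-column-sum : ∀ {m n} (X : Fin m → Carrier) (Y : Fin n → Carrier) → ∑ 𝔽 X ≡ 0# →
    ∀ j → ∑ 𝔽 (λ i → (X ⊗ Y) i j) ≡ 0#
  ⊗-column-sum X Y ∑X≡0 j = trans (∑-*ʳ (Y j) X) (trans (cong (_* Y j) ∑X≡0) (zeroˡ (Y j)))

  module _ {m n : ℕ} {A : Matrix 𝔽 m n} {u : Fin m → Carrier} {v : Fin n → Carrier}
           (A≡u⊗v : ∀ i j → A i j ≡ (u ⊗ v) i j) where

    IsHeffter⇒factors-IsZeroSumSubsetOfUnits : IsHeffter 𝔽 A → Fin m × Fin n →
      IsZeroSumSubsetOfUnits 𝔽 u × IsZeroSumSubsetOfUnits 𝔽 v
    IsHeffter⇒factors-IsZeroSumSubsetOfUnits A-heffter@((_ , A≢0 , _) , _) (i₀ , j₀) =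
        IsZeroSumSubsetOfUnits-*ʳ⁻¹ (x*y≢0⇒y≢0 u₀v₀≢0) (λ i → A≡u⊗v i j₀)
          (IsHeffter⇒column-IsZeroSumSubsetOfUnits A-heffter j₀)
      , IsZeroSumSubsetOfUnits-*ʳ⁻¹ (x*y≢0⇒x≢0 u₀v₀≢0)
          (λ j → trans (A≡u⊗v i₀ j) (*-comm (u i₀) (v j)))
          (IsHeffter⇒row-IsZeroSumSubsetOfUnits A-heffter i₀)
      where
      u₀v₀≢0 : u i₀ * v j₀ ≢ 0#
      u₀v₀≢0 = A≢0 (i₀ , j₀) ∘ trans (A≡u⊗v i₀ j₀)

    Factorizes-∘↔ : ∀ {ℓ} (e : Fin ℓ ↔ (Fin m × Fin n)) →
      (∀ p p′ → uncurry A p ≡ uncurry A p′ → p ≡ p′) →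
      Factorizes 𝔽 (uncurry A ∘ Inverse.to e) u v
    Factorizes-∘↔ e A-injective =
        (λ k → let p = Inverse.to e k in
           p , sym (A≡u⊗v (proj₁ p) (proj₂ p)) ,
           λ p′ u⊗v[p′]≡A[p] →
             A-injective p′ p (trans (A≡u⊗v (proj₁ p′) (proj₂ p′)) u⊗v[p′]≡A[p]))
      , (λ i j → Inverse.from e (i , j) ,
           trans (cong (uncurry A) (Inverse.strictlyInverseˡ e (i , j))) (A≡u⊗v i j))

  module _ {ℓ m n : ℕ} {V : Fin ℓ → Carrier} {X : Fin m → Carrier} {Y : Fin n → Carrier}
           (V-factorizes : Factorizes 𝔽 V X Y) where

    Factorizes⇒⊗-injective : ∀ p p′ → uncurry (X ⊗ Y) p ≡ uncurry (X ⊗ Y) p′ → p ≡ p′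
    Factorizes⇒⊗-injective p p′ X⊗Y[p]≡X⊗Y[p′] =
      let (k , V[k]≡X⊗Y[p]) = proj₂ V-factorizes (proj₁ p) (proj₂ p)
          (_ , _ , unique) = proj₁ V-factorizes k
      in trans (unique p (sym V[k]≡X⊗Y[p]))
               (sym (unique p′ (trans (sym X⊗Y[p]≡X⊗Y[p′]) (sym V[k]≡X⊗Y[p]))))

    Factorizes⇒⊗-IsHalfSet : IsHalfSet 𝔽 V → (∀ i → X i ≢ 0#) → (∀ j → Y j ≢ 0#) →
      IsHalfSet 𝔽 (uncurry (X ⊗ Y))
    Factorizes⇒⊗-IsHalfSet V-half X≢0 Y≢0 =
      IsHalfSet-⊇ V-half Factorizes⇒⊗-injective
        (λ (i , j) → x≢0∧y≢0⇒x*y≢0 (X≢0 i) (Y≢0 j))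
        (λ k → let (p , X⊗Y[p]≡V[k] , _) = proj₁ V-factorizes k in p , X⊗Y[p]≡V[k])

  RankOneHeffterArray : ℕ → ℕ → Set
  RankOneHeffterArray m n = Σ (Matrix 𝔽 m n) λ A → IsHeffter 𝔽 A × IsRankOne 𝔽 A

  HalfSetFactorization : ℕ → ℕ → ℕ → Set
  HalfSetFactorization ℓ m n =
    Σ (Fin ℓ → Carrier) λ V → Σ (Fin m → Carrier) λ X → Σ (Fin n → Carrier) λ Y →
      IsHalfSet 𝔽 V × IsZeroSumSubsetOfUnits 𝔽 X × IsZeroSumSubsetOfUnits 𝔽 Y
      × Factorizes 𝔽 V X Y

  RankOneHeffterArray⇒HalfSetFactorization : ∀ {ℓ m n} → Fin ℓ ↔ (Fin m × Fin n) →
    RankOneHeffterArray m n → HalfSetFactorization ℓ m n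
  RankOneHeffterArray⇒HalfSetFactorization e
    (A , A-heffter@(A-half , _) , (p₀ , _) , u , v , A≡u⊗v) =
    let (u-zeroSum , v-zeroSum) = IsHeffter⇒factors-IsZeroSumSubsetOfUnits A≡u⊗v A-heffter p₀
    in  uncurry A ∘ Inverse.to e , u , v
      , IsHalfSet-∘↔ e A-half , u-zeroSum , v-zeroSum
      , Factorizes-∘↔ A≡u⊗v e (proj₁ A-half)

  HalfSetFactorization⇒RankOneHeffterArray : ∀ {ℓ m n} →
    HalfSetFactorization ℓ m n → RankOneHeffterArray m n
  HalfSetFactorization⇒RankOneHeffterArray
    (V , X , Y , V-half , (_ , X≢0 , ∑X≡0) , (_ , Y≢0 , ∑Y≡0) , V-factorizes) =
      X ⊗ Y , (X⊗Y-half , ⊗-row-sum X Y ∑Y≡0 , ⊗-column-sum X Y ∑X≡0)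
    , (p₀ , proj₁ (proj₂ X⊗Y-half) p₀) , X , Y , (λ _ _ → refl)
    where
    X⊗Y-half : IsHalfSet 𝔽 (uncurry (X ⊗ Y))
    X⊗Y-half = Factorizes⇒⊗-IsHalfSet V-factorizes V-half X≢0 Y≢0

    p₀ : Fin _ × Fin _
    p₀ = IsHalfSet⇒inhabited X⊗Y-half

-- Imported only now, so as not to clash with the field operations opened above.
open import Data.Nat using (_+_; _*_)

proposition2 : (m n : ℕ) → IsPrimePower (2 * m * n + 1) →
    (𝔽 : FiniteField (2 * m * n + 1)) →
    (Σ (Matrix 𝔽 m n) λ A → IsHeffter 𝔽 A × IsRankOne 𝔽 A)
    ⇔
    (Σ (Fin (m * n) → FiniteField.Carrier 𝔽) λ V →
     Σ (Fin m → FiniteField.Carrier 𝔽) λ X →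
     Σ (Fin n → FiniteField.Carrier 𝔽) λ Y →
       IsHalfSet 𝔽 V × IsZeroSumSubsetOfUnits 𝔽 X × IsZeroSumSubsetOfUnits 𝔽 Y
       × Factorizes 𝔽 V X Y)
proposition2 m n _ 𝔽 = mk⇔
  (RankOneHeffterArray⇒HalfSetFactorization 𝔽 *↔×)
  (HalfSetFactorization⇒RankOneHeffterArray 𝔽)
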